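{- Let $T$ be a homeomorphically irreducible tree and let $s$ and $s'$ be $T$-admissible sequences of the same length with $\mathrm{sig}_s=\mathrm{sig}_{s'}$. If $s$ and $s'$ are both canonical, then $s=s'$.
   Context: A tree is homeomorphically irreducible if it has no vertex of degree two; $V_{br}(T)$ is its set of branch vertices (degree $\ge 3$); $\mathrm{dist}$ is distance in $T$. A rooted subtree has a designated root $\mathrm{rt}$; empty rooted subtrees are allowed. A $T$-admissible sequence is a finite sequence $t=\langle T_1,\dots,T_l\rangle$ of (possibly empty) rooted subtrees of $T$ whose vertex sets form a partition of $V_{br}(T)$ (empty blocks allowed); equality of sequences means equality term by term as rooted trees. Its signature is $\mathrm{sig}_t:V_{br}(T)\to\mathbb{Z}^+$, $\mathrm{sig}_t(v)=\mathrm{dist}(v,\mathrm{rt}(T_i))+i$ where $v\in V(T_i)$. $t$ is canonical if there are no $1\le i<j\le l$, $w\in V(T_i)$, $v\in V(T_j)$ with $w$ adjacent to $v$ and $\mathrm{sig}_t(v)=\mathrm{sig}_t(w)+1$. -}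

module Defs where

open import Data.Nat using (ℕ; zero; suc; _+_; _≤_; _<_; _≥_)
open import Data.Fin using (Fin; toℕ)
open import Data.Fin.Subset using (Subset; _∈_)
open import Data.Bool using (Bool; true; false)
open import Data.List using (List; []; _∷_; length; filterᵇ; allFin)
open import Data.List.Relation.Unary.Unique.Propositional using (Unique)
open import Data.Maybe using (Maybe; just; nothing)
open import Data.Vec using (Vec; lookup)
open import Data.Product using (Σ; ∃; ∃-syntax; _×_; _,_)
open import Data.Unit using (⊤)
open import Data.Empty using (⊥)
open import Relation.Nullary using (¬_)
open import Relation.Binary.PropositionalEquality using (_≡_; _≢_)

record Graph (n : ℕ) : Set where
  field
    adj    : Fin n → Fin n → Bool
    symm   : ∀ u v → adj u v ≡ adj v u
    noLoop : ∀ v → adj v v ≡ false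
open Graph public

module _ {n : ℕ} (G : Graph n) where

  Adj : Fin n → Fin n → Set
  Adj u v = adj G u v ≡ true

  degree : Fin n → ℕ
  degree v = length (filterᵇ (adj G v) (allFin n))

  IsBranch : Fin n → Set
  IsBranch v = degree v ≥ 3

  HomeomorphicallyIrreducible : Set
  HomeomorphicallyIrreducible = ∀ v → degree v ≢ 2

  data WalkIn (P : Fin n → Set) : Fin n → Fin n → ℕ → Set where
    here : ∀ {v} → P v → WalkIn P v v zero
    step : ∀ {u v w k} → P u → Adj u v → WalkIn P v w k → WalkIn P u w (suc k)

  Walk : Fin n → Fin n → ℕ → Set
  Walk = WalkIn (λ _ → ⊤)

  IsWalkList : List (Fin n) → Set
  IsWalkList []            = ⊤
  IsWalkList (_ ∷ [])      = ⊤
  IsWalkList (u ∷ v ∷ vs)  = Adj u v × IsWalkList (v ∷ vs)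

  IsCycle : Fin n → List (Fin n) → Set
  IsCycle v₀ vs = Σ (Fin n) λ vk →
    3 ≤ length (v₀ ∷ vs) × Unique (v₀ ∷ vs) × IsWalkList (v₀ ∷ vs)
      × LastIs (v₀ ∷ vs) vk × Adj vk v₀
    where
    LastIs : List (Fin n) → Fin n → Set
    LastIs []           x = ⊥
    LastIs (y ∷ [])     x = y ≡ x
    LastIs (_ ∷ y ∷ ys) x = LastIs (y ∷ ys) x

  Connected : Set
  Connected = ∀ u v → ∃[ k ] Walk u v k

  Acyclic : Set
  Acyclic = ∀ v₀ vs → ¬ IsCycle v₀ vs

  IsTree : Set
  IsTree = 1 ≤ n × Connected × Acyclic

  IsDistance : (Fin n → Fin n → ℕ) → Set
  IsDistance d = ∀ u v → Walk u v (d u v) × (∀ k → Walk u v k → d u v ≤ k)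

-- A (possibly empty) rooted subtree: nothing = empty; just (S , r) = vertex set S with root r.
-- (A subtree of a tree is determined by its vertex set: its edges are those of T between
-- vertices of S.)
RSub : ℕ → Set
RSub n = Maybe (Subset n × Fin n)

_∈ᵣ_ : ∀ {n} → Fin n → RSub n → Set
v ∈ᵣ nothing      = ⊥
v ∈ᵣ just (S , r) = v ∈ S

module _ {n : ℕ} (G : Graph n) where

  IsRootedSubtree : RSub n → Set
  IsRootedSubtree nothing       = ⊤
  IsRootedSubtree (just (S , r)) =
    r ∈ S × (∀ u v → u ∈ S → v ∈ S → ∃[ k ] WalkIn G (_∈ S) u v k)

  -- T-admissible sequence ⟨T₁,…,T_l⟩ (index i : Fin l stands for i+1)
  Admissible : ∀ {l} → Vec (RSub n) l → Set
  Admissible {l} t =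
      (∀ i → IsRootedSubtree (lookup t i))
    × (∀ v → IsBranch G v → ∃[ i ] (v ∈ᵣ lookup t i))
    × (∀ v i → v ∈ᵣ lookup t i → IsBranch G v)
    × (∀ v i j → v ∈ᵣ lookup t i → v ∈ᵣ lookup t j → i ≡ j)

  Sig : (Fin n → Fin n → ℕ) → ∀ {l} → Vec (RSub n) l → Fin n → ℕ → Set
  Sig d {l} t v k = Σ (Fin l) λ i → Σ (Subset n) λ S → Σ (Fin n) λ r →
    lookup t i ≡ just (S , r) × v ∈ S × k ≡ d v r + suc (toℕ i)

  SameSig : (Fin n → Fin n → ℕ) → ∀ {l} → Vec (RSub n) l → Vec (RSub n) l → Set
  SameSig d s s' = ∀ v k → (Sig d s v k → Sig d s' v k) × (Sig d s' v k → Sig d s v k)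

  Canonical : (Fin n → Fin n → ℕ) → ∀ {l} → Vec (RSub n) l → Set
  Canonical d {l} t = ¬ (Σ (Fin l) λ i → Σ (Fin l) λ j → Σ (Fin n) λ w → Σ (Fin n) λ v →
    Σ ℕ λ kw → Σ ℕ λ kv →
      toℕ i < toℕ j × w ∈ᵣ lookup t i × v ∈ᵣ lookup t j × Adj G w v
      × Sig d t w kw × Sig d t v kv × kv ≡ suc kw)

{-# OPTIONS --safe #-}
-- Induction on the block index i, assuming s and s′ agree on all earlier blocks.  If T_i has
-- root r, then sig(r) = i + 1; the block of s′ containing r is not earlier (those are blocks of s,
-- disjoint from T_i) and not later (signatures in block j are at least j + 1), so it is T′_i, and
-- its root is r because their distance is 0.  Every v ∈ T_i then lies in T′_i, by induction on
-- dist(v, r): the neighbour w of v towards r lies in the subtree T_i, hence in T′_i; v is a branch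
-- vertex, so it lies in some block of s′, and a block later than T′_i would make the edge w v, with
-- sig(v) = sig(w) + 1, contradict canonicity of s′.  Symmetrically T′_i ⊆ T_i.
module Submission where

open import Defs
open import Data.Nat as ℕ using (ℕ; zero; suc; _+_; z≤n; s≤s)
open import Data.Nat.Properties as ℕ using (m≤n+m; +-cancelʳ-≡)
open import Data.Fin as Fin using (Fin; toℕ; _≟_)
open import Data.Fin.Properties using (<-cmp; <-irrefl)
open import Data.Fin.Induction using (<-wellFounded)
open import Data.Fin.Subset using (Subset; _∈_; _⊆_)
open import Data.Fin.Subset.Properties using (_∈?_; ⊆-antisym)
open import Data.List using (List; []; _∷_)
open import Data.List.Relation.Unary.All as All using (All; []; _∷_)
open import Data.List.Relation.Unary.AllPairs using ([]; _∷_)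
open import Data.List.Relation.Unary.Unique.Propositional using (Unique)
open import Data.Maybe using (Maybe; just; nothing)
open import Data.Vec using (Vec; lookup)
open import Data.Vec.Relation.Binary.Pointwise.Extensional using (ext; Pointwise-≡⇒≡)
open import Data.Product using (Σ; ∃-syntax; _×_; _,_; proj₁; proj₂; swap)
open import Data.Sum using (_⊎_; inj₁; inj₂)
open import Data.Unit using (tt)
open import Data.Empty using (⊥-elim)
open import Induction.WellFounded using (module All)
open import Relation.Nullary using (¬_; yes; no)
open import Relation.Binary.Definitions using (tri<; tri≈; tri>)
open import Relation.Binary.PropositionalEquality using (_≡_; _≢_; refl; sym; trans; cong; subst; ≢-sym)

private
  Σ-family : (X : Set) {A : Set} {B : A → Set} → X ≡ Σ A B → A → Set
  Σ-family _ {B = B} _ = B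

  fourth : (X : Set) {P₁ P₂ P₃ P₄ P₅ : Set} → X ≡ (P₁ × P₂ × P₃ × P₄ × P₅) → Set
  fourth _ {P₄ = P₄} _ = P₄

-- `IsCycle` says "the last vertex of v₀ ∷ vs is vk" through a function local to its
-- definition; `EndsAt` is that predicate, read off from the type of `IsCycle`.
EndsAt : ∀ {n} → Graph n → Fin n → List (Fin n) → Fin n → Set
EndsAt G v₀ vs vk = fourth (Σ-family (IsCycle G v₀ vs) refl vk) refl

module _ {n : ℕ} (G : Graph n) where

  Adj-sym : ∀ {u v} → Adj G u v → Adj G v u
  Adj-sym {u} {v} uv = trans (symm G v u) uv

  WalkIn-map : ∀ {P Q : Fin n → Set} → (∀ {x} → P x → Q x) →
               ∀ {a b k} → WalkIn G P a b k → WalkIn G Q a b k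
  WalkIn-map f (here pa)       = here (f pa)
  WalkIn-map f (step pa ab w)  = step (f pa) ab (WalkIn-map f w)

  WalkIn-++ : ∀ {P : Fin n → Set} {a b c k m} →
              WalkIn G P a b k → WalkIn G P b c m → WalkIn G P a c (k + m)
  WalkIn-++ (here _)        w′ = w′
  WalkIn-++ (step pa ab w)  w′ = step pa ab (WalkIn-++ w w′)

  WalkIn-target : ∀ {P : Fin n → Set} {a b k} → WalkIn G P a b k → P b
  WalkIn-target (here pb)     = pb
  WalkIn-target (step _ _ w)  = WalkIn-target w

  first-arrival : ∀ {Q : Fin n → Set} {a b m} → WalkIn G Q a b m → a ≢ b →
                  Σ (Fin n) λ u → Σ ℕ λ k → WalkIn G (λ x → Q x × x ≢ b) a u k × Adj G u b
  first-arrival (here _) a≢b = ⊥-elim (a≢b refl)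
  first-arrival {b = b} (step {u = a} {v = y} qa ay w) a≢b with y ≟ b
  ... | yes refl = a , zero , here (qa , a≢b) , ay
  ... | no y≢b with first-arrival w y≢b
  ...   | u , k , w′ , ub = u , suc k , step (qa , a≢b) ay w′ , ub

  record Path (P : Fin n → Set) (a b : Fin n) : Set where
    constructor mkPath
    field
      rest   : List (Fin n)
      unique : Unique (a ∷ rest)
      walk   : IsWalkList G (a ∷ rest)
      ends   : EndsAt G a rest b
      inside : All P (a ∷ rest)
  open Path

  path-from-or-avoiding : ∀ {P : Fin n → Set} {x b} a (p : Path P x b) →
                          Path P a b ⊎ All (_≢ a) (x ∷ rest p)
  path-from-or-avoiding {x = x} a p with x ≟ a
  ... | yes refl = inj₁ p
  path-from-or-avoiding a (mkPath [] _ _ _ _) | no x≢a = inj₂ (x≢a ∷ [])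
  path-from-or-avoiding a (mkPath (_ ∷ ys) (_ ∷ uniq) (_ , walk) ends (_ ∷ inside)) | no x≢a
    with path-from-or-avoiding a (mkPath ys uniq walk ends inside)
  ... | inj₁ q     = inj₁ q
  ... | inj₂ avoid = inj₂ (x≢a ∷ avoid)

  path-∷ : ∀ {P : Fin n → Set} {a y b} → P a → Adj G a y →
           (p : Path P y b) → All (_≢ a) (y ∷ rest p) → Path P a b
  path-∷ pa ay (mkPath ys uniq walk ends inside) avoid =
    mkPath (_ ∷ ys) (All.map ≢-sym avoid ∷ uniq) (ay , walk) ends (pa ∷ inside)

  walk⇒path : ∀ {P : Fin n → Set} {a b k} → WalkIn G P a b k → Path P a b
  walk⇒path (here pa) = mkPath [] ([] ∷ []) tt refl (pa ∷ [])
  walk⇒path {a = a} (step pa ay w) with path-from-or-avoiding a (walk⇒path w)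
  ... | inj₁ p     = p
  ... | inj₂ avoid = path-∷ pa ay (walk⇒path w) avoid

  path-closes-cycle : ∀ {v p u} → Adj G v p → Adj G u v → p ≢ u →
                      (q : Path (_≢ v) p u) → IsCycle G v (p ∷ rest q)
  path-closes-cycle _ _ p≢u (mkPath [] _ _ p≡u _) = ⊥-elim (p≢u p≡u)
  path-closes-cycle vp uv _ (mkPath (_ ∷ _) uniq walk ends avoid) =
    _ , s≤s (s≤s (s≤s z≤n)) , All.map ≢-sym avoid ∷ uniq , (vp , walk) , ends , uv

  acyclic-neighbours-separated : Acyclic G → ∀ {v p u k} → Adj G v p → Adj G u v → p ≢ u →
                                 ¬ WalkIn G (_≢ v) p u k
  acyclic-neighbours-separated acyclic vp uv p≢u w =
    acyclic _ _ (path-closes-cycle vp uv p≢u (walk⇒path w))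

module Distance {n : ℕ} (G : Graph n) (d : Fin n → Fin n → ℕ) (isD : IsDistance G d) where

  private
    geodesic : ∀ u v → Walk G u v (d u v)
    geodesic u v = proj₁ (isD u v)

    dist-≤ : ∀ {u v k} → Walk G u v k → d u v ℕ.≤ k
    dist-≤ {u} {v} {k} = proj₂ (isD u v) k

  dist-self : ∀ u → d u u ≡ 0
  dist-self u = ℕ.n≤0⇒n≡0 (dist-≤ (here tt))

  dist-zero⇒≡ : ∀ {u v} → d u v ≡ 0 → u ≡ v
  dist-zero⇒≡ {u} {v} uv with subst (Walk G u v) uv (geodesic u v)
  ... | here _ = refl

  dist-step : ∀ {v r k} → d v r ≡ suc k →
              Σ (Fin n) λ p → Adj G v p × d p r ≡ k × Walk G p r k
  dist-step {v} {r} {k} vr with subst (Walk G v r) vr (geodesic v r)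
  ... | step {v = p} _ vp pr = p , vp , ℕ.≤-antisym (dist-≤ pr) k≤pr , pr
    where
    k≤pr : k ℕ.≤ d p r
    k≤pr = ℕ.≤-pred (subst (ℕ._≤ suc (d p r)) vr (dist-≤ (step tt vp (geodesic p r))))

  walk-shorter⇒≢ : ∀ {v r x j} → Walk G x r j → j ℕ.< d v r → x ≢ v
  walk-shorter⇒≢ w j<vr refl = ℕ.<⇒≱ j<vr (dist-≤ w)

  walk-shorter-avoids : ∀ {v r x j} → Walk G x r j → j ℕ.< d v r → WalkIn G (_≢ v) x r j
  walk-shorter-avoids w@(here _)       j<vr = here (walk-shorter⇒≢ w j<vr)
  walk-shorter-avoids w@(step _ xy w′) j<vr =
    step (walk-shorter⇒≢ w j<vr) xy (walk-shorter-avoids w′ (ℕ.<⇒≤ j<vr))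

  dist-suc⇒≢ : ∀ {v r k} → d v r ≡ suc k → r ≢ v
  dist-suc⇒≢ {r = r} vr refl = ℕ.0≢1+n (trans (sym (dist-self r)) vr)

  -- If the next vertex p on a geodesic from v to r left S, then the rest of that geodesic followed
  -- by a walk in S from r to its first arrival at v would join two neighbours of v avoiding v.
  subtree-parent : Acyclic G → ∀ {S r v k} → IsRootedSubtree G (just (S , r)) →
                   v ∈ S → d v r ≡ suc k →
                   Σ (Fin n) λ w → w ∈ S × Adj G w v × d w r ≡ k
  subtree-parent acyclic {S} {r} {v} {k} (r∈S , connected) v∈S vr
    with dist-step vr | first-arrival G (proj₂ (connected r v r∈S v∈S)) (dist-suc⇒≢ vr)
  ... | p , vp , pr , walk-pr | u , m , walk-ru , uv with p ∈? S
  ...   | yes p∈S = p , p∈S , Adj-sym G vp , pr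
  ...   | no p∉S  = ⊥-elim (acyclic-neighbours-separated G acyclic vp uv p≢u
                               (WalkIn-++ G walk-pr-avoiding-v walk-ru-avoiding-v))
    where
    p≢u : p ≢ u
    p≢u p≡u = p∉S (subst (_∈ S) (sym p≡u) (proj₁ (WalkIn-target G walk-ru)))
    walk-pr-avoiding-v : WalkIn G (_≢ v) p r k
    walk-pr-avoiding-v = walk-shorter-avoids walk-pr (subst (k ℕ.<_) (sym vr) (ℕ.n<1+n k))
    walk-ru-avoiding-v : WalkIn G (_≢ v) r u m
    walk-ru-avoiding-v = WalkIn-map G proj₂ walk-ru

AgreeBelow : ∀ {A : Set} {l} → Vec A l → Vec A l → Fin l → Set
AgreeBelow t t′ i = ∀ j → j Fin.< i → lookup t j ≡ lookup t′ j

just-determined : ∀ {A : Set} {a b : Maybe A} →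
                  (∀ {x} → a ≡ just x → b ≡ just x) → (∀ {x} → b ≡ just x → a ≡ just x) → a ≡ b
just-determined {a = just x}                  a⇒b _   = sym (a⇒b refl)
just-determined {a = nothing} {b = nothing}   _   _   = refl
just-determined {a = nothing} {b = just y}    _   b⇒a with () ← b⇒a refl

module Blocks {n l : ℕ} (T : Graph n) (d : Fin n → Fin n → ℕ) (t : Vec (RSub n) l) where

  ∈-block : ∀ {i S r v} → lookup t i ≡ just (S , r) → v ∈ S → v ∈ᵣ lookup t i
  ∈-block {v = v} ti v∈S = subst (v ∈ᵣ_) (sym ti) v∈S

  block-rooted : Admissible T t → ∀ {i S r} → lookup t i ≡ just (S , r) →
                 IsRootedSubtree T (just (S , r))
  block-rooted (rooted , _) {i} ti = subst (IsRootedSubtree T) ti (rooted i)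

  root-∈-block : Admissible T t → ∀ {i S r} → lookup t i ≡ just (S , r) → r ∈ S
  root-∈-block adm ti = proj₁ (block-rooted adm ti)

  sig-in-block : ∀ {i S r v} → lookup t i ≡ just (S , r) → v ∈ S →
                 Sig T d t v (d v r + suc (toℕ i))
  sig-in-block {i} {S} {r} ti v∈S = i , S , r , ti , v∈S , refl

  block-not-before : Admissible T t → (t′ : Vec (RSub n) l) → ∀ {i j v} → AgreeBelow t t′ i →
                     v ∈ᵣ lookup t i → v ∈ᵣ lookup t′ j → ¬ (j Fin.< i)
  block-not-before (_ , _ , _ , disjoint) _ {i} {j} {v} agree v∈i v∈j′ j<i =
    <-irrefl (disjoint v j i (subst (v ∈ᵣ_) (sym (agree j j<i)) v∈j′) v∈i) j<i

  canonical-no-later-successor : Canonical T d t →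
    ∀ {i j S r w v} → lookup t i ≡ just (S , r) → w ∈ S → v ∈ᵣ lookup t j → Adj T w v →
    Sig T d t v (suc (d w r + suc (toℕ i))) → ¬ (i Fin.< j)
  canonical-no-later-successor canonical {i} {j} ti w∈S v∈j wv sig-v i<j =
    canonical (i , j , _ , _ , _ , _ , i<j , ∈-block ti w∈S , v∈j , wv ,
               sig-in-block ti w∈S , sig-v , refl)

module Transfer {n l : ℕ} (T : Graph n) (d : Fin n → Fin n → ℕ)
    (isD : IsDistance T d) (acyclic : Acyclic T)
    (s s′ : Vec (RSub n) l) (adm : Admissible T s) (adm′ : Admissible T s′)
    (sig⇒sig′ : ∀ v k → Sig T d s v k → Sig T d s′ v k) (canonical′ : Canonical T d s′) where
  open Distance T d isD
  module B = Blocks T d s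
  module B′ = Blocks T d s′

  sig-root : ∀ {i S r} → lookup s i ≡ just (S , r) → Sig T d s r (suc (toℕ i))
  sig-root {i} {S} {r} si = subst (Sig T d s r) (cong (_+ suc (toℕ i)) (dist-self r))
                                  (B.sig-in-block si (B.root-∈-block adm si))

  root-preserved : ∀ {i S r} → AgreeBelow s s′ i → lookup s i ≡ just (S , r) →
                   Σ (Subset n) λ S′ → lookup s′ i ≡ just (S′ , r)
  root-preserved {i} {S} {r} agree si with sig⇒sig′ r _ (sig-root si)
  ... | j , S′ , r′ , s′j , r∈S′ , e with <-cmp i j
  ...   | tri< i<j _ _ =
    ⊥-elim (ℕ.<⇒≱ (s≤s i<j) (subst (suc (toℕ j) ℕ.≤_) (sym e) (m≤n+m _ (d r r′))))
  ...   | tri> _ _ j<i =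
    ⊥-elim (B.block-not-before adm s′ agree (B.∈-block si (B.root-∈-block adm si))
                                             (B′.∈-block s′j r∈S′) j<i)
  ...   | tri≈ _ refl _ with dist-zero⇒≡ (sym (+-cancelʳ-≡ (suc (toℕ i)) 0 (d r r′) e))
  ...     | refl = S′ , s′j

  block-⊆ : ∀ {i S S′ r} → AgreeBelow s s′ i →
            lookup s i ≡ just (S , r) → lookup s′ i ≡ just (S′ , r) → S ⊆ S′
  block-⊆ {i} {S} {S′} {r} agree si s′i v∈S = by-distance _ v∈S refl
    where
    covers′ : ∀ v → IsBranch T v → ∃[ j ] (v ∈ᵣ lookup s′ j)
    covers′ = proj₁ (proj₂ adm′)
    branch : ∀ v i → v ∈ᵣ lookup s i → IsBranch T v
    branch = proj₁ (proj₂ (proj₂ adm))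
    by-distance : ∀ k {v} → v ∈ S → d v r ≡ k → v ∈ S′
    by-distance zero v∈S vr with dist-zero⇒≡ vr
    ... | refl = B′.root-∈-block adm′ s′i
    by-distance (suc k) {v} v∈S vr with subtree-parent acyclic (B.block-rooted adm si) v∈S vr
    ... | w , w∈S , wv , wr with covers′ v (branch v i (B.∈-block si v∈S))
    ...   | j , v∈j with <-cmp i j
    ...     | tri≈ _ refl _ = subst (v ∈ᵣ_) s′i v∈j
    ...     | tri> _ _ j<i = ⊥-elim (B.block-not-before adm s′ agree (B.∈-block si v∈S) v∈j j<i)
    ...     | tri< i<j _ _ =
      ⊥-elim (B′.canonical-no-later-successor canonical′ s′i (by-distance k w∈S wr) v∈j wv sig-v i<j)
      where
      sig-v : Sig T d s′ v (suc (d w r + suc (toℕ i)))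
      sig-v = subst (Sig T d s′ v) (cong (_+ suc (toℕ i)) (trans vr (cong suc (sym wr))))
                    (sig⇒sig′ v _ (B.sig-in-block si v∈S))

nonempty-block-agrees : ∀ {n l} (T : Graph n) (d : Fin n → Fin n → ℕ) → IsDistance T d → Acyclic T →
  (s s′ : Vec (RSub n) l) → Admissible T s → Admissible T s′ → SameSig T d s s′ →
  Canonical T d s → Canonical T d s′ →
  ∀ {i x} → AgreeBelow s s′ i → lookup s i ≡ just x → lookup s′ i ≡ just x
nonempty-block-agrees T d isD acyclic s s′ adm adm′ same canonical canonical′ {i} {S , r} agree si =
  trans s′i (cong (λ X → just (X , r)) (⊆-antisym (Backward.block-⊆ agree′ s′i si)
                                                   (Forward.block-⊆ agree si s′i)))
  where
  module Forward = Transfer T d isD acyclic s s′ adm adm′ (λ v k → proj₁ (same v k)) canonical′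
  module Backward = Transfer T d isD acyclic s′ s adm′ adm (λ v k → proj₂ (same v k)) canonical
  s′i : lookup s′ i ≡ just (proj₁ (Forward.root-preserved agree si) , r)
  s′i = proj₂ (Forward.root-preserved agree si)
  agree′ : AgreeBelow s′ s i
  agree′ j j<i = sym (agree j j<i)

lemma3p10 : ∀ {n l} (T : Graph n) (dist : Fin n → Fin n → ℕ)
    → IsTree T → HomeomorphicallyIrreducible T → IsDistance T dist
    → (s s' : Vec (RSub n) l)
    → Admissible T s → Admissible T s'
    → SameSig T dist s s'
    → Canonical T dist s → Canonical T dist s'
    → s ≡ s'
lemma3p10 T dist (_ , _ , acyclic) _ isD s s′ adm adm′ same canonical canonical′ =
  Pointwise-≡⇒≡ (ext (All.wfRec <-wellFounded _ (λ i → lookup s i ≡ lookup s′ i) block-agrees))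
  where
  block-agrees : ∀ i → (∀ {j} → j Fin.< i → lookup s j ≡ lookup s′ j) → lookup s i ≡ lookup s′ i
  block-agrees i below = just-determined
    (nonempty-block-agrees T dist isD acyclic s s′ adm adm′ same canonical canonical′ (λ _ → below))
    (nonempty-block-agrees T dist isD acyclic s′ s adm′ adm (λ v k → swap (same v k)) canonical′ canonical
                           (λ _ j<i → sym (below j<i)))
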